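{- Let $A,B$ be sets of nonnegative integers that are additive complements with $$\limsup_{x\to\infty}\frac{A(x)B(x)}{x}<1+C_0,\qquad C_0=\tfrac12\left(-3-\sqrt2+\sqrt{3+12\sqrt2}\right)=0.027315\ldots.$$ Then $\displaystyle\lim_{x\to\infty}\frac{\max\{A(x),B(x)\}}{\sqrt x}=\infty$.
   Context: Two sets $A,B$ of nonnegative integers are called additive complements if every sufficiently large integer can be written as $a+b$ with $a\in A$, $b\in B$. For a set $A$ of nonnegative integers, $A(x)$ denotes the number of elements $a\in A$ with $a\le x$. -}

module Defs where

open import Data.Nat using (ℕ; zero; suc; _+_; _*_; _∸_; _^_; _≤_; _<_; _⊔_)
open import Data.Bool using (Bool; true; false; if_then_else_)
open import Data.Product using (_×_; ∃-syntax)
open import Relation.Binary.PropositionalEquality using (_≡_)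

NatSet : Set
NatSet = ℕ → Bool

count : NatSet → ℕ → ℕ
count A zero    = if A zero then 1 else 0
count A (suc x) = count A x + (if A (suc x) then 1 else 0)

AdditiveComplements : NatSet → NatSet → Set
AdditiveComplements A B =
  ∃[ n₀ ] (∀ n → n₀ ≤ n → ∃[ a ] ∃[ b ] (A a ≡ true × B b ≡ true × a + b ≡ n))

-- For a nonnegative rational q = p / r (r > 0):
--   LtOnePlusC₀ p r  ⇔  q < 1 + C₀,  C₀ = (−3 − √2 + √(3 + 12√2)) / 2.
-- Derivation: with t = 2q + 1 ≥ 1,  q < 1 + C₀ ⇔ t + √2 < √(3 + 12√2)
--   ⇔ t² − 1 < (12 − 2t)√2  ⇔  t < 6 ∧ (t² − 1)² < 2(12 − 2t)²   (as t² − 1 ≥ 0).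
-- With t = s / r, s = 2p + r, and clearing denominators (multiply by r⁴):
--   s < 6r ∧ (s² − r²)² < 2 r² (12r − 2s)².
LtOnePlusC₀ : ℕ → ℕ → Set
LtOnePlusC₀ p r =
  let s = 2 * p + r in
  (s < 6 * r) × ((s * s ∸ r * r) ^ 2 < 2 * (r * r) * (12 * r ∸ 2 * s) ^ 2)

-- limsup_{x→∞} A(x)B(x)/x < 1 + C₀ : there is a rational q = p/r < 1 + C₀
-- with A(x)B(x) ≤ q x for all sufficiently large x.
LimsupProductBelow : NatSet → NatSet → Set
LimsupProductBelow A B =
  ∃[ p ] ∃[ r ] (0 < r × LtOnePlusC₀ p r ×
    ∃[ x₀ ] (∀ x → x₀ ≤ x → count A x * count B x * r ≤ p * x))

-- lim_{x→∞} max{A(x),B(x)} / √x = ∞ : for every M, eventually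
-- max{A(x),B(x)}² ≥ M x  (equivalently max/√x ≥ √M).
MaxOverSqrtTendsToInfinity : NatSet → NatSet → Set
MaxOverSqrtTendsToInfinity A B =
  ∀ (M : ℕ) → ∃[ x₀ ] (∀ x → x₀ ≤ x →
    M * x ≤ (count A x ⊔ count B x) * (count A x ⊔ count B x))

{-# OPTIONS --safe #-}
module Submission where

-- Write a(x) = A(x) and b(x) = B(x). The hypothesis gives a(x) b(x) ≤ q x eventually for some
-- q < 1 + C₀ < 33/32, and 33/32 is all that is used about C₀. Counting the representations n = a + b ≤ z,
-- split according to a ≤ y or a > y, gives z ≲ a(y) b(z) + (a(z) − a(y)) b(y) for z ≤ 2y. With z = y
-- this is x ≲ a(x) b(x); with z = 2y it forbids a and b to grow both by a factor above 13/10 on [y, 2y].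
-- Call a set slow at y if it grows by at most 13/10 there, so for large y one of A, B is slow at y.
-- Slowness cannot pass from A at y to B at y + 1, for then a(2y + 2) b(2y + 2) ≲ (13/10)² (33/32)(y + 1)
-- < 2y + 2; and a set with fewer than 20 elements up to y gains no further element, by the same two
-- bounds. Hence one set, say A, is slow at every large y, and iterating gives a(x) ≲ x^(log₂ 1.3),
-- so that b(x) ≳ x / a(x) grows strictly faster than √x.

open import Data.Bool using (Bool; true; false; if_then_else_; _∧_)
open import Data.Empty using (⊥; ⊥-elim)
open import Data.Fin using (Fin; zero; suc; toℕ; fromℕ; fromℕ<; inject₁)
open import Data.Fin.Properties using (toℕ-fromℕ; toℕ-fromℕ<; toℕ-inject₁)
open import Data.List using (_∷_; [])
open import Data.Nat using (ℕ; zero; suc; _+_; _*_; _∸_; _^_; _⊔_; _≤_; _<_; _≰_; _≤′_; ≤′-refl; ≤′-step;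
  z≤n; s≤s; z<s; s<s; _≟_; _≤?_; _<?_; NonZero; >-nonZero)
open import Data.Nat.Properties
open import Data.Nat.Tactic.RingSolver using (solve)
open import Data.Product using (_×_; _,_; ∃-syntax)
open import Data.Sum using (_⊎_; inj₁; inj₂; [_,_]′)
open import Data.Vec.Functional using (Vector)
open import Function using (_∘_; id)
open import Relation.Binary.PropositionalEquality
  using (_≡_; refl; sym; trans; cong; cong₂; subst; subst₂; module ≡-Reasoning)
open import Relation.Nullary using (¬_; yes; no; does)
open import Relation.Nullary.Decidable using (dec-true; dec-false)

open import Algebra.Properties.CommutativeSemigroup *-commutativeSemigroup
  using (x∙yz≈y∙xz; xy∙z≈y∙xz) renaming (interchange to *-interchange)
open import Algebra.Properties.Semiring.Sum +-*-semiring
  using (sum; sum-syntax; sum⁺-syntax; ∑-comm; ∑-distrib-+; *-distribˡ-sum; *-distribʳ-sum;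
         sum-cong-≗; sum-init-last; sum-remove; sum-replicate-zero)

open import Defs

𝟙 : Bool → ℕ
𝟙 b = if b then 1 else 0

∑-mono-≤ : ∀ {n} {f g : Vector ℕ n} → (∀ i → f i ≤ g i) → sum f ≤ sum g
∑-mono-≤ {zero}  f≤g = ≤-refl
∑-mono-≤ {suc n} f≤g = +-mono-≤ (f≤g zero) (∑-mono-≤ (f≤g ∘ suc))

term≤sum : ∀ {n} (f : Vector ℕ (suc n)) i → f i ≤ sum f
term≤sum f i = ≤-trans (m≤m+n (f i) _) (≤-reflexive (sym (sum-remove f)))

∑-indicator-≡≤1 : ∀ k c → ∑[ n < k ] 𝟙 (does (c ≟ toℕ n)) ≤ 1
∑-indicator-≡≤1 zero    c       = z≤n
∑-indicator-≡≤1 (suc k) zero    = ≤-reflexive (cong suc (sum-replicate-zero k))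
∑-indicator-≡≤1 (suc k) (suc c) = ∑-indicator-≡≤1 k c

count≡∑ : ∀ A x → count A x ≡ ∑[ i ≤ x ] 𝟙 (A (toℕ i))
count≡∑ A zero    = sym (+-identityʳ _)
count≡∑ A (suc x) = begin
  count A x + 𝟙 (A (suc x))
    ≡⟨ cong₂ _+_ (count≡∑ A x) (cong (𝟙 ∘ A) (sym (toℕ-fromℕ (suc x)))) ⟩
  ∑[ i ≤ x ] 𝟙 (A (toℕ i)) + 𝟙 (A (toℕ (fromℕ (suc x))))
    ≡⟨ cong (_+ 𝟙 (A (toℕ (fromℕ (suc x))))) (sum-cong-≗ {suc x} (cong (𝟙 ∘ A) ∘ sym ∘ toℕ-inject₁)) ⟩
  ∑[ i ≤ x ] 𝟙 (A (toℕ (inject₁ i))) + 𝟙 (A (toℕ (fromℕ (suc x))))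
    ≡⟨ sym (sum-init-last {suc x} (𝟙 ∘ A ∘ toℕ)) ⟩
  ∑[ i ≤ suc x ] 𝟙 (A (toℕ i)) ∎
  where open ≡-Reasoning

covering-≤-∑ : ∀ n₀ k (f : ℕ → ℕ) → (∀ n → n₀ ≤ n → n < k → 1 ≤ f n) →
           k ≤ n₀ + ∑[ n < k ] f (toℕ n)
covering-≤-∑ n₀       zero    f hit = z≤n
covering-≤-∑ zero     (suc k) f hit =
  +-mono-≤ (hit 0 z≤n z<s) (covering-≤-∑ 0 k (f ∘ suc) λ n _ n<k → hit (suc n) z≤n (s<s n<k))
covering-≤-∑ (suc n₀) (suc k) f hit = begin
  suc k                 ≤⟨ s≤s (covering-≤-∑ n₀ k (f ∘ suc) hit-suc) ⟩
  suc n₀ + rest         ≤⟨ +-monoʳ-≤ (suc n₀) (m≤n+m rest (f 0)) ⟩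
  suc n₀ + (f 0 + rest) ∎
  where
  open ≤-Reasoning
  rest = ∑[ n < k ] f (suc (toℕ n))
  hit-suc : ∀ n → n₀ ≤ n → n < k → 1 ≤ f (suc n)
  hit-suc n n₀≤n n<k = hit (suc n) (s≤s n₀≤n) (s<s n<k)

representations : NatSet → NatSet → ℕ → ℕ → ℕ → ℕ
representations A B m m′ n =
  ∑[ a ≤ m ] ∑[ b ≤ m′ ] (𝟙 (A (toℕ a)) * 𝟙 (B (toℕ b)) * 𝟙 (does (toℕ a + toℕ b ≟ n)))

∑-representations≤ : ∀ A B m m′ z → ∑[ n ≤ z ] representations A B m m′ (toℕ n) ≤ count A m * count B m′
∑-representations≤ A B m m′ z = begin
  ∑[ n ≤ z ] ∑[ a ≤ m ] ∑[ b ≤ m′ ] (w a b * δ a b n)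
    ≡⟨ ∑-comm (λ n a → ∑[ b ≤ m′ ] (w a b * δ a b n)) ⟩
  ∑[ a ≤ m ] ∑[ n ≤ z ] ∑[ b ≤ m′ ] (w a b * δ a b n)
    ≡⟨ sum-cong-≗ (λ a → ∑-comm (λ n b → w a b * δ a b n)) ⟩
  ∑[ a ≤ m ] ∑[ b ≤ m′ ] ∑[ n ≤ z ] (w a b * δ a b n)
    ≡⟨ sum-cong-≗ (λ a → sum-cong-≗ (λ b → sym (*-distribˡ-sum (w a b) (δ a b)))) ⟩
  ∑[ a ≤ m ] ∑[ b ≤ m′ ] (w a b * ∑[ n ≤ z ] δ a b n)
    ≤⟨ ∑-mono-≤ (λ a → ∑-mono-≤ (λ b → *-monoʳ-≤ (w a b) (∑-indicator-≡≤1 (suc z) (toℕ a + toℕ b)))) ⟩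
  ∑[ a ≤ m ] ∑[ b ≤ m′ ] (w a b * 1)
    ≡⟨ sum-cong-≗ (λ a → sum-cong-≗ (λ b → *-identityʳ (w a b))) ⟩
  ∑[ a ≤ m ] ∑[ b ≤ m′ ] (𝟙A a * 𝟙B b)
    ≡⟨ sum-cong-≗ (λ a → sym (*-distribˡ-sum (𝟙A a) 𝟙B)) ⟩
  ∑[ a ≤ m ] (𝟙A a * ∑[ b ≤ m′ ] 𝟙B b)
    ≡⟨ sym (*-distribʳ-sum (∑[ b ≤ m′ ] 𝟙B b) 𝟙A) ⟩
  ∑[ a ≤ m ] 𝟙A a * ∑[ b ≤ m′ ] 𝟙B b
    ≡⟨ sym (cong₂ _*_ (count≡∑ A m) (count≡∑ B m′)) ⟩
  count A m * count B m′ ∎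
  where
  open ≤-Reasoning
  𝟙A : Vector ℕ (suc m)
  𝟙A a = 𝟙 (A (toℕ a))
  𝟙B : Vector ℕ (suc m′)
  𝟙B b = 𝟙 (B (toℕ b))
  w : Fin (suc m) → Fin (suc m′) → ℕ
  w a b = 𝟙A a * 𝟙B b
  δ : Fin (suc m) → Fin (suc m′) → Fin (suc z) → ℕ
  δ a b n = 𝟙 (does (toℕ a + toℕ b ≟ toℕ n))

representations-pos : ∀ A B {a b m m′} → A a ≡ true → B b ≡ true → a ≤ m → b ≤ m′ →
                      1 ≤ representations A B m m′ (a + b)
representations-pos A B {a} {b} {m} {m′} Aa Bb a≤m b≤m′ =
  ≤-trans (≤-reflexive pair-term≡1) (≤-trans (term≤sum (pair-term i) j) (term≤sum row i))
  where
  pair-term : Fin (suc m) → Fin (suc m′) → ℕ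
  pair-term a′ b′ = 𝟙 (A (toℕ a′)) * 𝟙 (B (toℕ b′)) * 𝟙 (does (toℕ a′ + toℕ b′ ≟ a + b))
  row : Fin (suc m) → ℕ
  row a′ = ∑[ b′ ≤ m′ ] pair-term a′ b′
  i = fromℕ< (s≤s a≤m)
  j = fromℕ< (s≤s b≤m′)
  pair-term≡1 : 1 ≡ 𝟙 (A (toℕ i)) * 𝟙 (B (toℕ j)) * 𝟙 (does (toℕ i + toℕ j ≟ a + b))
  pair-term≡1 rewrite toℕ-fromℕ< (s≤s a≤m) | toℕ-fromℕ< (s≤s b≤m′) | Aa | Bb
                    | dec-true (a + b ≟ a + b) refl = refl

above : ℕ → NatSet → NatSet
above y A a = does (y <? a) ∧ A a

count-above-≤ : ∀ A {x y} → x ≤ y → count (above y A) x ≡ 0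
count-above-≤ A {zero}  {y} _ rewrite dec-false (y <? 0) (λ ()) = refl
count-above-≤ A {suc x} {y} x<y rewrite dec-false (y <? suc x) (≤⇒≯ x<y) =
  trans (+-identityʳ _) (count-above-≤ A (<⇒≤ x<y))

count-above : ∀ A {y z} → y ≤ z → count A y + count (above y A) z ≡ count A z
count-above A {y} = split ∘ ≤⇒≤′
  where
  open ≡-Reasoning
  split : ∀ {z} → y ≤′ z → count A y + count (above y A) z ≡ count A z
  split ≤′-refl                  = trans (cong (count A y +_) (count-above-≤ A {y} ≤-refl)) (+-identityʳ _)
  split (≤′-step {n = z} y≤′z) = begin
    count A y + (count (above y A) z + 𝟙 (does (y <? suc z) ∧ A (suc z)))
      ≡⟨ cong (λ t → count A y + (count (above y A) z + 𝟙 (t ∧ A (suc z))))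
              (dec-true (y <? suc z) (s≤s (≤′⇒≤ y≤′z))) ⟩
    count A y + (count (above y A) z + 𝟙 (A (suc z)))
      ≡⟨ sym (+-assoc (count A y) _ _) ⟩
    count A y + count (above y A) z + 𝟙 (A (suc z))
      ≡⟨ cong (_+ 𝟙 (A (suc z))) (split y≤′z) ⟩
    count A (suc z) ∎

𝟙≤1 : ∀ b → 𝟙 b ≤ 1
𝟙≤1 false = z≤n
𝟙≤1 true  = ≤-refl

count-mono : ∀ A {x y} → x ≤ y → count A x ≤ count A y
count-mono A = mono ∘ ≤⇒≤′
  where
  mono : ∀ {x y} → x ≤′ y → count A x ≤ count A y
  mono ≤′-refl          = ≤-refl
  mono (≤′-step x≤′y) = ≤-trans (mono x≤′y) (m≤m+n _ _)

count-+-≤ : ∀ A k x → count A (k + x) ≤ count A x + k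
count-+-≤ A zero    x = m≤m+n (count A x) 0
count-+-≤ A (suc k) x = begin
  count A (k + x) + 𝟙 (A (suc (k + x)))  ≤⟨ +-mono-≤ (count-+-≤ A k x) (𝟙≤1 _) ⟩
  count A x + k + 1                      ≡⟨ +-assoc (count A x) k 1 ⟩
  count A x + (k + 1)                    ≡⟨ cong (count A x +_) (+-comm k 1) ⟩
  count A x + suc k                      ∎
  where open ≤-Reasoning

count-suc-true : ∀ A {x} → A (suc x) ≡ true → count A (suc x) ≡ suc (count A x)
count-suc-true A {x} A[x+1] rewrite A[x+1] = +-comm (count A x) 1

SumsCoverFrom : ℕ → NatSet → NatSet → Set
SumsCoverFrom n₀ A B = ∀ n → n₀ ≤ n → ∃[ a ] ∃[ b ] (A a ≡ true × B b ≡ true × a + b ≡ n)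

sums-cover-swap : ∀ {n₀ A B} → SumsCoverFrom n₀ A B → SumsCoverFrom n₀ B A
sums-cover-swap cover n n₀≤n with cover n n₀≤n
... | a , b , Aa , Bb , a+b≡n = b , a , Bb , Aa , trans (+-comm b a) a+b≡n

module _ {A B : NatSet} {n₀ : ℕ} (cover : SumsCoverFrom n₀ A B) where

  count-product-lower : ∀ x → suc x ≤ n₀ + count A x * count B x
  count-product-lower x = begin
    suc x
      ≤⟨ covering-≤-∑ n₀ (suc x) (representations A B x x) hit ⟩
    n₀ + ∑[ n ≤ x ] representations A B x x (toℕ n)
      ≤⟨ +-monoʳ-≤ n₀ (∑-representations≤ A B x x x) ⟩
    n₀ + count A x * count B x ∎
    where
    open ≤-Reasoning
    hit : ∀ n → n₀ ≤ n → n < suc x → 1 ≤ representations A B x x n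
    hit n n₀≤n (s≤s n≤x) with cover n n₀≤n
    ... | a , b , Aa , Bb , refl =
      representations-pos A B Aa Bb (≤-trans (m≤m+n a b) n≤x) (≤-trans (m≤n+m b a) n≤x)

  -- A representation n = a + b ≤ z with a > y has b < y, because z ≤ 2y.
  count-split-lower : ∀ {y z} → z ≤ 2 * y →
    suc z ≤ n₀ + (count A y * count B z + count (above y A) z * count B y)
  count-split-lower {y} {z} z≤2y = begin
    suc z
      ≤⟨ covering-≤-∑ n₀ (suc z) (λ n → low n + high n) hit ⟩
    n₀ + ∑[ n ≤ z ] (low (toℕ n) + high (toℕ n))
      ≡⟨ cong (n₀ +_) (∑-distrib-+ {suc z} (low ∘ toℕ) (high ∘ toℕ)) ⟩
    n₀ + (∑[ n ≤ z ] low (toℕ n) + ∑[ n ≤ z ] high (toℕ n))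
      ≤⟨ +-monoʳ-≤ n₀ (+-mono-≤ (∑-representations≤ A B y z z) (∑-representations≤ (above y A) B z y z)) ⟩
    n₀ + (count A y * count B z + count (above y A) z * count B y) ∎
    where
    open ≤-Reasoning
    low high : ℕ → ℕ
    low  = representations A B y z
    high = representations (above y A) B z y
    hit : ∀ n → n₀ ≤ n → n < suc z → 1 ≤ low n + high n
    hit n n₀≤n (s≤s n≤z) with cover n n₀≤n
    ... | a , b , Aa , Bb , refl with a ≤? y
    ...   | yes a≤y = ≤-trans (representations-pos A B Aa Bb a≤y (≤-trans (m≤n+m b a) n≤z))
                              (m≤m+n _ (high (a + b)))
    ...   | no  a≰y = ≤-trans (representations-pos (above y A) B aboveAa Bb (≤-trans (m≤m+n a b) n≤z)
                                                   (<⇒≤ b<y))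
                              (m≤n+m _ (low (a + b)))
      where
      y<a = ≰⇒> a≰y
      aboveAa : above y A a ≡ true
      aboveAa rewrite dec-true (y <? a) y<a = Aa
      b<y : b < y
      b<y = +-cancelˡ-< y b y (begin-strict
        y + b  ≡⟨ +-comm y b ⟩
        b + y  <⟨ +-monoʳ-< b y<a ⟩
        b + a  ≡⟨ +-comm b a ⟩
        a + b  ≤⟨ ≤-trans n≤z z≤2y ⟩
        2 * y  ≡⟨ cong (y +_) (+-identityʳ y) ⟩
        y + y  ∎)

-- 17/12 ≥ √2, since 17² = 289 ≥ 288 = 2 ⋅ 12².
≤-√2-scaled : ∀ {x y} → 17 * x ≤ 12 * y → 2 * (x * x) ≤ y * y
≤-√2-scaled {x} {y} 17x≤12y = *-cancelˡ-≤ 144 (begin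
  144 * (2 * (x * x))       ≡⟨ solve (x ∷ []) ⟩
  288 * (x * x)             ≤⟨ *-monoˡ-≤ (x * x) (m≤m+n 288 1) ⟩
  289 * (x * x)             ≡⟨ solve (x ∷ []) ⟩
  (17 * x) * (17 * x)       ≤⟨ *-mono-≤ 17x≤12y 17x≤12y ⟩
  (12 * y) * (12 * y)       ≡⟨ solve (y ∷ []) ⟩
  144 * (y * y)             ∎)
  where open ≤-Reasoning

-- With d = s² − r² and e = 12r − 2s, the target d² ≥ 2 r² e² follows from 12 d ≥ 17 r e, which is the
-- hypothesis after adding 12 r² + 34 rs to both sides.
c₀-gap-closes : ∀ {r s d e} → 216 * (r * r) ≤ 12 * (s * s) + 34 * (r * s) →
                d + r * r ≡ s * s → e + 2 * s ≡ 12 * r → 2 * (r * r) * (e * e) ≤ d * d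
c₀-gap-closes {r} {s} {d} {e} 216r²≤ d+r²≡s² e+2s≡12r = begin
  2 * (r * r) * (e * e)    ≡⟨ solve (r ∷ e ∷ []) ⟩
  2 * ((r * e) * (r * e))  ≤⟨ ≤-√2-scaled {r * e} {d} 17re≤12d ⟩
  d * d                    ∎
  where
  open ≤-Reasoning
  17re≤12d : 17 * (r * e) ≤ 12 * d
  17re≤12d = +-cancelʳ-≤ (12 * (r * r) + 34 * (r * s)) (17 * (r * e)) (12 * d) (begin
    17 * (r * e) + (12 * (r * r) + 34 * (r * s))  ≡⟨ solve (r ∷ e ∷ s ∷ []) ⟩
    17 * r * (e + 2 * s) + 12 * (r * r)           ≡⟨ cong (λ t → 17 * r * t + 12 * (r * r)) e+2s≡12r ⟩
    17 * r * (12 * r) + 12 * (r * r)              ≡⟨ solve (r ∷ []) ⟩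
    216 * (r * r)                                 ≤⟨ 216r²≤ ⟩
    12 * (s * s) + 34 * (r * s)                   ≡⟨ cong (λ t → 12 * t + 34 * (r * s)) (sym d+r²≡s²) ⟩
    12 * (d + r * r) + 34 * (r * s)               ≡⟨ solve (d ∷ r ∷ s ∷ []) ⟩
    12 * d + (12 * (r * r) + 34 * (r * s))        ∎)

-- Writing p = r + k, the hypothesis says r ≤ 32 k, and s = 2p + r = 3r + 2k.
c₀-quadratic-bound : ∀ {p r} → 33 * r ≤ 32 * p →
  216 * (r * r) ≤ 12 * ((2 * p + r) * (2 * p + r)) + 34 * (r * (2 * p + r))
c₀-quadratic-bound {p} {r} 33r≤32p =
  subst (λ t → 216 * (r * r) ≤ 12 * ((2 * t + r) * (2 * t + r)) + 34 * (r * (2 * t + r)))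
        r+k≡p (bound (p ∸ r) r≤32k)
  where
  open ≤-Reasoning
  r≤p : r ≤ p
  r≤p = *-cancelˡ-≤ 33 (≤-trans 33r≤32p (*-monoˡ-≤ p (m≤m+n 32 1)))
  r+k≡p : r + (p ∸ r) ≡ p
  r+k≡p = m+[n∸m]≡n r≤p
  r≤32k : r ≤ 32 * (p ∸ r)
  r≤32k = +-cancelˡ-≤ (32 * r) r _ (begin
    32 * r + r              ≡⟨ solve (r ∷ []) ⟩
    33 * r                  ≤⟨ 33r≤32p ⟩
    32 * p                  ≡⟨ cong (32 *_) (sym r+k≡p) ⟩
    32 * (r + (p ∸ r))      ≡⟨ *-distribˡ-+ 32 r (p ∸ r) ⟩
    32 * r + 32 * (p ∸ r)   ∎)
  bound : ∀ k → r ≤ 32 * k →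
          216 * (r * r) ≤ 12 * ((2 * (r + k) + r) * (2 * (r + k) + r)) + 34 * (r * (2 * (r + k) + r))
  bound k r≤32k = begin
    216 * (r * r)
      ≡⟨ solve (r ∷ []) ⟩
    210 * (r * r) + 6 * (r * r)
      ≤⟨ +-monoʳ-≤ (210 * (r * r)) (*-monoʳ-≤ 6 (*-monoʳ-≤ r r≤32k)) ⟩
    210 * (r * r) + 6 * (r * (32 * k))
      ≤⟨ +-monoʳ-≤ (210 * (r * r)) (m≤m+n _ _) ⟩
    210 * (r * r) + (6 * (r * (32 * k)) + (20 * (r * k) + 48 * (k * k)))
      ≡⟨ solve (r ∷ k ∷ []) ⟩
    12 * ((2 * (r + k) + r) * (2 * (r + k) + r)) + 34 * (r * (2 * (r + k) + r)) ∎

1+C₀<33/32 : ∀ {p r} → LtOnePlusC₀ p r → 32 * p < 33 * r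
1+C₀<33/32 {p} {r} (s<6r , gap) = ≰⇒> λ 33r≤32p →
  <⇒≱ gap (subst₂ (λ u v → 2 * (r * r) * u ≤ v) (sym (square e)) (sym (square d))
                  (c₀-gap-closes {r} {s} {d} {e} (c₀-quadratic-bound {p} 33r≤32p)
                                 (m∸n+n≡m r²≤s²) (m∸n+n≡m 2s≤12r)))
  where
  s = 2 * p + r
  d = s * s ∸ r * r
  e = 12 * r ∸ 2 * s
  square : ∀ x → x ^ 2 ≡ x * x
  square x = cong (x *_) (*-identityʳ x)
  r²≤s² : r * r ≤ s * s
  r²≤s² = *-mono-≤ (m≤n+m r (2 * p)) (m≤n+m r (2 * p))
  2s≤12r : 2 * s ≤ 12 * r
  2s≤12r = ≤-trans (*-monoʳ-≤ 2 (<⇒≤ s<6r)) (≤-reflexive (sym (*-assoc 2 6 r)))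

^-distribʳ-* : ∀ m n j → (m * n) ^ j ≡ m ^ j * n ^ j
^-distribʳ-* m n zero    = refl
^-distribʳ-* m n (suc j) = begin
  m * n * (m * n) ^ j      ≡⟨ cong (m * n *_) (^-distribʳ-* m n j) ⟩
  m * n * (m ^ j * n ^ j)  ≡⟨ *-interchange m n (m ^ j) (n ^ j) ⟩
  m * m ^ j * (n * n ^ j)  ∎
  where open ≡-Reasoning

bernoulli : ∀ a d j → a ^ j * (a + j * d) ≤ a * (a + d) ^ j
bernoulli a d zero    = ≤-reflexive (solve (a ∷ []))
bernoulli a d (suc j) = begin
  a * a ^ j * (a + suc j * d)       ≡⟨ xy∙z≈y∙xz a (a ^ j) _ ⟩
  a ^ j * (a * (a + suc j * d))     ≤⟨ *-monoʳ-≤ (a ^ j) one-step ⟩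
  a ^ j * ((a + d) * (a + j * d))   ≡⟨ x∙yz≈y∙xz (a ^ j) (a + d) _ ⟩
  (a + d) * (a ^ j * (a + j * d))   ≤⟨ *-monoʳ-≤ (a + d) (bernoulli a d j) ⟩
  (a + d) * (a * (a + d) ^ j)       ≡⟨ x∙yz≈y∙xz (a + d) a _ ⟩
  a * ((a + d) * (a + d) ^ j)       ∎
  where
  open ≤-Reasoning
  one-step : a * (a + suc j * d) ≤ (a + d) * (a + j * d)
  one-step = begin
    a * (a + suc j * d)                 ≤⟨ m≤m+n _ (j * d * d) ⟩
    a * (a + suc j * d) + j * d * d     ≡⟨ solve (a ∷ d ∷ j ∷ []) ⟩
    (a + d) * (a + j * d)               ∎

pow-outgrows : ∀ a d N j .{{_ : NonZero a}} → a * N ≤ j * d → N * a ^ j ≤ (a + d) ^ j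
pow-outgrows a d N j aN≤jd = *-cancelˡ-≤ a (begin
  a * (N * a ^ j)      ≡⟨ sym (*-assoc a N (a ^ j)) ⟩
  a * N * a ^ j        ≡⟨ *-comm (a * N) (a ^ j) ⟩
  a ^ j * (a * N)      ≤⟨ *-monoʳ-≤ (a ^ j) (≤-trans aN≤jd (m≤n+m (j * d) a)) ⟩
  a ^ j * (a + j * d)  ≤⟨ bernoulli a d j ⟩
  a * (a + d) ^ j      ∎)
  where open ≤-Reasoning

module _ {f : ℕ → ℕ} {u v T : ℕ} (doubling : ∀ y → T ≤ y → u * f (2 * y) ≤ v * f y) where

  iterate-doubling : ∀ j {y} → T ≤ y → u ^ j * f (2 ^ j * y) ≤ v ^ j * f y
  iterate-doubling zero    {y} _   = ≤-reflexive (cong (λ t → 1 * f t) (*-identityˡ y))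
  iterate-doubling (suc j) {y} T≤y = begin
    u * u ^ j * f (2 * 2 ^ j * y)     ≡⟨ cong₂ _*_ (*-comm u (u ^ j)) (cong f (*-assoc 2 (2 ^ j) y)) ⟩
    u ^ j * u * f (2 * (2 ^ j * y))   ≡⟨ *-assoc (u ^ j) u _ ⟩
    u ^ j * (u * f (2 * (2 ^ j * y))) ≤⟨ *-monoʳ-≤ (u ^ j) (doubling (2 ^ j * y) T≤2ʲy) ⟩
    u ^ j * (v * f (2 ^ j * y))       ≡⟨ x∙yz≈y∙xz (u ^ j) v _ ⟩
    v * (u ^ j * f (2 ^ j * y))       ≤⟨ *-monoʳ-≤ v (iterate-doubling j T≤y) ⟩
    v * (v ^ j * f y)                 ≡⟨ sym (*-assoc v (v ^ j) (f y)) ⟩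
    v * v ^ j * f y                   ∎
    where
    open ≤-Reasoning
    T≤2ʲy : T ≤ 2 ^ j * y
    T≤2ʲy = ≤-trans T≤y (m≤n*m y (2 ^ j) {{m^n≢0 2 j}})

n<2*n : ∀ {n} → 0 < n → n < 2 * n
n<2*n {n} 0<n = <-≤-trans (m<m+n n 0<n) (≤-reflexive (cong (n +_) (sym (+-identityʳ n))))

dyadic-block : ∀ {T x} → 0 < T → T ≤ x → ∃[ j ] (2 ^ j * T ≤ x × x < 2 ^ suc j * T)
dyadic-block {T} 0<T = block ∘ ≤⇒≤′
  where
  block : ∀ {x} → T ≤′ x → ∃[ j ] (2 ^ j * T ≤ x × x < 2 ^ suc j * T)
  block ≤′-refl = 0 , ≤-reflexive (*-identityˡ T) , n<2*n 0<T
  block (≤′-step {n = x} T≤′x) with block T≤′x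
  ... | j , lo , hi with suc x <? 2 ^ suc j * T
  ...   | yes x+1<hi = j , ≤-trans lo (n≤1+n x) , x+1<hi
  ...   | no  x+1≮hi = suc j , ≤-reflexive (sym x+1≡) , (begin-strict
          suc x                  <⟨ n<2*n z<s ⟩
          2 * suc x              ≡⟨ cong (2 *_) x+1≡ ⟩
          2 * (2 ^ suc j * T)    ≡⟨ sym (*-assoc 2 (2 ^ suc j) T) ⟩
          2 ^ suc (suc j) * T    ∎)
    where
    open ≤-Reasoning
    x+1≡ : suc x ≡ 2 ^ suc j * T
    x+1≡ = ≤-antisym hi (≮⇒≥ x+1≮hi)

≤-33/32-scaled : ∀ {p r m x} → 0 < r → 32 * p < 33 * r → m * r ≤ p * x → 32 * m ≤ 33 * x
≤-33/32-scaled {p} {r} {m} {x} 0<r 32p<33r mr≤px = *-cancelˡ-≤ r {{>-nonZero 0<r}} (begin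
  r * (32 * m)   ≡⟨ solve (r ∷ m ∷ []) ⟩
  32 * (m * r)   ≤⟨ *-monoʳ-≤ 32 mr≤px ⟩
  32 * (p * x)   ≡⟨ sym (*-assoc 32 p x) ⟩
  32 * p * x     ≤⟨ *-monoˡ-≤ x (<⇒≤ 32p<33r) ⟩
  33 * r * x     ≡⟨ solve (r ∷ x ∷ []) ⟩
  r * (33 * x)   ∎)
  where open ≤-Reasoning

not-slow⇒gap : ∀ {a D} → 10 * (a + D) ≰ 13 * a → 3 * a ≤ 10 * D
not-slow⇒gap {a} {D} fast = ≮⇒≥ λ 10D<3a → fast (begin
  10 * (a + D)      ≡⟨ *-distribˡ-+ 10 a D ⟩
  10 * a + 10 * D   ≤⟨ +-monoʳ-≤ (10 * a) (<⇒≤ 10D<3a) ⟩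
  10 * a + 3 * a    ≡⟨ solve (a ∷ []) ⟩
  13 * a            ∎)
  where open ≤-Reasoning

-- Both factors grow by more than 13/10 on [y, 2y], so the product gains at least (3/10)² a b ≈ 0.09 y
-- on top of the 2y forced by the covering; this exceeds the room (33/32) ⋅ 2y − 2y = y/16.
both-fast-impossible : ∀ {n₀ y a b D v} → 40 * n₀ ≤ y →
  suc (2 * y) ≤ n₀ + (a * (b + v) + D * b) → suc y ≤ n₀ + a * b →
  3 * a ≤ 10 * D → 3 * b ≤ 10 * v → 32 * ((a + D) * (b + v)) ≤ 33 * (2 * y) → ⊥
both-fast-impossible {n₀} {y} {a} {b} {D} {v} 40n₀≤y split lower 3a≤10D 3b≤10v upper =
  m+1+n≰m (6688 * y) (begin
    6688 * y + 3488
      ≡⟨ solve (y ∷ []) ⟩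
    32 * (100 * suc (2 * y) + 9 * suc y)
      ≤⟨ *-monoʳ-≤ 32 (+-mono-≤ (*-monoʳ-≤ 100 split) (*-monoʳ-≤ 9 lower)) ⟩
    32 * (100 * (n₀ + (a * (b + v) + D * b)) + 9 * (n₀ + a * b))
      ≡⟨ solve (n₀ ∷ a ∷ b ∷ v ∷ D ∷ []) ⟩
    3488 * n₀ + 32 * (100 * (a * (b + v) + D * b) + (3 * a) * (3 * b))
      ≤⟨ +-monoʳ-≤ (3488 * n₀) (*-monoʳ-≤ 32 (+-monoʳ-≤ (100 * (a * (b + v) + D * b))
                                                          (*-mono-≤ 3a≤10D 3b≤10v))) ⟩
    3488 * n₀ + 32 * (100 * (a * (b + v) + D * b) + (10 * D) * (10 * v))
      ≡⟨ solve (n₀ ∷ a ∷ b ∷ v ∷ D ∷ []) ⟩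
    3488 * n₀ + 100 * (32 * ((a + D) * (b + v)))
      ≤⟨ +-monoʳ-≤ (3488 * n₀) (*-monoʳ-≤ 100 upper) ⟩
    3488 * n₀ + 100 * (33 * (2 * y))
      ≤⟨ +-monoˡ-≤ _ 3488n₀≤88y ⟩
    88 * y + 100 * (33 * (2 * y))
      ≡⟨ solve (y ∷ []) ⟩
    6688 * y ∎)
  where
  open ≤-Reasoning
  3488n₀≤88y : 3488 * n₀ ≤ 88 * y
  3488n₀≤88y = begin
    3488 * n₀          ≤⟨ *-monoˡ-≤ n₀ (m≤m+n 3488 32) ⟩
    3520 * n₀          ≡⟨ *-assoc 88 40 n₀ ⟩
    88 * (40 * n₀)     ≤⟨ *-monoʳ-≤ 88 40n₀≤y ⟩
    88 * y             ∎

-- At 2(y + 1) the product is at most (14/10)(13/10) ⋅ (33/32)(y + 1) < 2(y + 1), against the covering;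
-- 14/10 rather than 13/10 absorbs the at most two elements of A in (2y, 2y + 2] once A(y + 1) ≥ 20.
slow-switch-impossible : ∀ {n₀ y a b a₂ b₂} → 9 * n₀ ≤ y → suc (2 * suc y) ≤ n₀ + a₂ * b₂ →
  10 * a₂ ≤ 14 * a → 10 * b₂ ≤ 13 * b → 32 * (a * b) ≤ 33 * suc y → ⊥
slow-switch-impossible {n₀} {y} {a} {b} {a₂} {b₂} 9n₀≤y lower a₂≤ b₂≤ upper =
  m+1+n≰m (6400 * y + 6006) (begin
    6400 * y + 6006 + 3594                ≡⟨ solve (y ∷ []) ⟩
    3200 * suc (2 * suc y)                ≤⟨ *-monoʳ-≤ 3200 lower ⟩
    3200 * (n₀ + a₂ * b₂)                 ≡⟨ solve (n₀ ∷ a₂ ∷ b₂ ∷ []) ⟩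
    3200 * n₀ + 32 * ((10 * a₂) * (10 * b₂))
                                          ≤⟨ +-monoʳ-≤ (3200 * n₀) (*-monoʳ-≤ 32 (*-mono-≤ a₂≤ b₂≤)) ⟩
    3200 * n₀ + 32 * ((14 * a) * (13 * b)) ≡⟨ solve (n₀ ∷ a ∷ b ∷ []) ⟩
    3200 * n₀ + 182 * (32 * (a * b))      ≤⟨ +-monoʳ-≤ (3200 * n₀) (*-monoʳ-≤ 182 upper) ⟩
    3200 * n₀ + 182 * (33 * suc y)        ≤⟨ +-monoˡ-≤ _ 3200n₀≤394y ⟩
    394 * y + 182 * (33 * suc y)          ≡⟨ solve (y ∷ []) ⟩
    6400 * y + 6006                       ∎)
  where
  open ≤-Reasoning
  3200n₀≤394y : 3200 * n₀ ≤ 394 * y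
  3200n₀≤394y = begin
    3200 * n₀          ≤⟨ *-monoˡ-≤ n₀ (m≤m+n 3200 346) ⟩
    3546 * n₀          ≡⟨ *-assoc 394 9 n₀ ⟩
    394 * (9 * n₀)     ≤⟨ *-monoʳ-≤ 394 9n₀≤y ⟩
    394 * y            ∎

-- A new element of A at w + 1, when A(w) = j < 20, would give (j + 1) B(w + 1) ≤ (33/32)(w + 1)
-- while j B(w) ≥ w + 1 − n₀, i.e. a ratio (j + 1)/j ≥ 21/20 > 33/32.
small-count-step-impossible : ∀ {n₀ w j b b₁} → 50 * n₀ ≤ w → j ≤ 19 → suc w ≤ n₀ + j * b → b ≤ b₁ →
  32 * (suc j * b₁) ≤ 33 * suc w → ⊥
small-count-step-impossible {n₀} {w} {j} {b} {b₁} 50n₀≤w j≤19 lower b≤b₁ upper =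
  <⇒≱ 640n₀<13[w+1] 13[w+1]≤640n₀
  where
  open ≤-Reasoning
  32[w+1]≤ : 32 * suc w ≤ 32 * suc j * n₀ + j * suc w
  32[w+1]≤ = +-cancelˡ-≤ (32 * j * suc w) _ _ (begin
    32 * j * suc w + 32 * suc w                     ≡⟨ solve (j ∷ w ∷ []) ⟩
    32 * suc j * suc w                              ≤⟨ *-monoʳ-≤ (32 * suc j) lower ⟩
    32 * suc j * (n₀ + j * b)
                                ≤⟨ *-monoʳ-≤ (32 * suc j) (+-monoʳ-≤ n₀ (*-monoʳ-≤ j b≤b₁)) ⟩
    32 * suc j * (n₀ + j * b₁)                      ≡⟨ solve (j ∷ n₀ ∷ b₁ ∷ []) ⟩
    32 * suc j * n₀ + j * (32 * (suc j * b₁))       ≤⟨ +-monoʳ-≤ (32 * suc j * n₀) (*-monoʳ-≤ j upper) ⟩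
    32 * suc j * n₀ + j * (33 * suc w)              ≡⟨ solve (j ∷ n₀ ∷ w ∷ []) ⟩
    32 * j * suc w + (32 * suc j * n₀ + j * suc w)  ∎)
  13[w+1]≤640n₀ : 13 * suc w ≤ 640 * n₀
  13[w+1]≤640n₀ = +-cancelʳ-≤ (19 * suc w) _ _ (begin
    13 * suc w + 19 * suc w          ≡⟨ solve (w ∷ []) ⟩
    32 * suc w                       ≤⟨ 32[w+1]≤ ⟩
    32 * suc j * n₀ + j * suc w      ≤⟨ +-mono-≤ (*-monoˡ-≤ n₀ (*-monoʳ-≤ 32 (s≤s j≤19)))
                                                 (*-monoˡ-≤ (suc w) j≤19) ⟩
    640 * n₀ + 19 * suc w            ∎)
  640n₀<13[w+1] : 640 * n₀ < 13 * suc w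
  640n₀<13[w+1] = begin-strict
    640 * n₀        ≤⟨ *-monoˡ-≤ n₀ (m≤m+n 640 10) ⟩
    650 * n₀        ≡⟨ *-assoc 13 50 n₀ ⟩
    13 * (50 * n₀)  ≤⟨ *-monoʳ-≤ 13 50n₀≤w ⟩
    13 * w          <⟨ *-monoʳ-< 13 (n<1+n w) ⟩
    13 * suc w      ∎

doubled-product-lower : ∀ {n₀ x m} → 2 * n₀ ≤ x → suc x ≤ n₀ + m → x ≤ 2 * m
doubled-product-lower {n₀} {x} {m} 2n₀≤x lower =
  +-cancelˡ-≤ x x (2 * m) (≤-trans (n≤1+n _) (+-cancelˡ-≤ (suc x) (suc (x + x)) (x + 2 * m) (begin
    suc x + suc (x + x)        ≡⟨ solve (x ∷ []) ⟩
    2 * suc x + x              ≤⟨ +-monoˡ-≤ x (*-monoʳ-≤ 2 lower) ⟩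
    2 * (n₀ + m) + x           ≡⟨ solve (n₀ ∷ m ∷ x ∷ []) ⟩
    2 * n₀ + (x + 2 * m)       ≤⟨ +-monoˡ-≤ (x + 2 * m) (≤-trans 2n₀≤x (n≤1+n x)) ⟩
    suc x + (x + 2 * m)        ∎)))
  where open ≤-Reasoning

-- Here P, Q, R stand for 10ʲ, 13ʲ, 2ʲ and w = 2ʲ T ≤ x ≤ 2w.
square-lower-bound : ∀ {M x w P Q R aw bw bx c} .{{_ : NonZero c}} .{{_ : NonZero Q}} →
  P * aw ≤ Q * c → w ≤ 2 * (aw * bw) → bw ≤ bx → x ≤ 2 * w → R ≤ w →
  8 * (c * c) * M * (Q * Q) ≤ R * (P * P) → M * x ≤ bx * bx
square-lower-bound {M} {x} {w} {P} {Q} {R} {aw} {bw} {bx} {c} Paw≤Qc w≤2awbw bw≤bx x≤2w R≤w outgrow =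
  *-cancelˡ-≤ (8 * (c * c) * (Q * Q)) {{K≢0}} (begin
    8 * (c * c) * (Q * Q) * (M * x)           ≡⟨ solve (c ∷ Q ∷ M ∷ x ∷ []) ⟩
    8 * (c * c) * M * (Q * Q) * x             ≤⟨ *-monoˡ-≤ x outgrow ⟩
    R * (P * P) * x                           ≤⟨ *-monoˡ-≤ x (*-monoˡ-≤ (P * P) R≤w) ⟩
    w * (P * P) * x                           ≤⟨ *-monoʳ-≤ (w * (P * P)) x≤2w ⟩
    w * (P * P) * (2 * w)                     ≡⟨ solve (w ∷ P ∷ []) ⟩
    2 * ((P * w) * (P * w))                   ≤⟨ *-monoʳ-≤ 2 (*-mono-≤ Pw≤ Pw≤) ⟩
    2 * ((2 * (Q * c) * bx) * (2 * (Q * c) * bx)) ≡⟨ solve (Q ∷ c ∷ bx ∷ []) ⟩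
    8 * (c * c) * (Q * Q) * (bx * bx)         ∎)
  where
  open ≤-Reasoning
  K≢0 : NonZero (8 * (c * c) * (Q * Q))
  K≢0 = m*n≢0 (8 * (c * c)) (Q * Q) {{m*n≢0 8 (c * c) {{_}} {{m*n≢0 c c}}}} {{m*n≢0 Q Q}}
  Pw≤ : P * w ≤ 2 * (Q * c) * bx
  Pw≤ = begin
    P * w                  ≤⟨ *-monoʳ-≤ P w≤2awbw ⟩
    P * (2 * (aw * bw))    ≡⟨ solve (P ∷ aw ∷ bw ∷ []) ⟩
    2 * (P * aw) * bw      ≤⟨ *-monoˡ-≤ bw (*-monoʳ-≤ 2 Paw≤Qc) ⟩
    2 * (Q * c) * bw       ≤⟨ *-monoʳ-≤ (2 * (Q * c)) bw≤bx ⟩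
    2 * (Q * c) * bx       ∎

Slow : NatSet → ℕ → Set
Slow A y = 10 * count A (2 * y) ≤ 13 * count A y

Eventually : (ℕ → Set) → Set
Eventually P = ∃[ x₀ ] (∀ x → x₀ ≤ x → P x)

eventually-mono : ∀ {P Q : ℕ → Set} → (∀ x → P x → Q x) → Eventually P → Eventually Q
eventually-mono P⇒Q (x₀ , P-from-x₀) = x₀ , λ x x₀≤x → P⇒Q x (P-from-x₀ x x₀≤x)

-- Iterating the doubling bound gives f(2ʲ T) ≤ (13/10)ʲ c with c = f(T) + 1, hence g(2ʲ T) ≳ (20/13)ʲ / c
-- and g(x)²/x ≳ (200/169)ʲ / c² for x ∈ [2ʲ T, 2ʲ⁺¹ T); by Bernoulli this exceeds M once j ≥ 169 ⋅ 8c²M.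
module _ {f g : ℕ → ℕ} {n₀ T : ℕ} (g-mono : ∀ {x y} → x ≤ y → g x ≤ g y)
         (product-lower : ∀ x → suc x ≤ n₀ + f x * g x) (2n₀≤T : 2 * n₀ ≤ T) (0<T : 0 < T) where

  slow-doubling⇒square-growth : (∀ y → T ≤ y → 10 * f (2 * y) ≤ 13 * f y) →
                                ∀ M → Eventually (λ x → M * x ≤ g x * g x)
  slow-doubling⇒square-growth slow M = 2 ^ J * T , bound
    where
    c = suc (f T)
    N = 8 * (c * c) * M
    J = 169 * N
    bound : ∀ x → 2 ^ J * T ≤ x → M * x ≤ g x * g x
    bound x x₀≤x with dyadic-block 0<T (≤-trans (m≤n*m T (2 ^ J) {{m^n≢0 2 J}}) x₀≤x)
    ... | j , lo , hi =
      square-lower-bound {M} {x} {w} {10 ^ j} {13 ^ j} {2 ^ j} {f w} {g w} {g x} {c} {{_}} {{m^n≢0 13 j}}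
        power-bound (doubled-product-lower {n₀} 2n₀≤w (product-lower w)) (g-mono lo) x≤2w
        (m≤m*n (2 ^ j) T {{>-nonZero 0<T}}) outgrow
      where
      w = 2 ^ j * T
      2n₀≤w : 2 * n₀ ≤ w
      2n₀≤w = ≤-trans 2n₀≤T (m≤n*m T (2 ^ j) {{m^n≢0 2 j}})
      J≤j : J ≤ j
      J≤j = ≮⇒≥ λ j<J → <⇒≱ (<-≤-trans hi (*-monoˡ-≤ T (^-monoʳ-≤ 2 j<J))) x₀≤x
      power-bound : 10 ^ j * f w ≤ 13 ^ j * c
      power-bound = ≤-trans (iterate-doubling {f = f} slow j ≤-refl) (*-monoʳ-≤ (13 ^ j) (n≤1+n (f T)))
      x≤2w : x ≤ 2 * w
      x≤2w = <⇒≤ (<-≤-trans hi (≤-reflexive (*-assoc 2 (2 ^ j) T)))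
      outgrow : N * (13 ^ j * 13 ^ j) ≤ 2 ^ j * (10 ^ j * 10 ^ j)
      outgrow = subst₂ _≤_ (cong (N *_) (^-distribʳ-* 13 13 j))
                           (trans (^-distribʳ-* 2 100 j) (cong (2 ^ j *_) (^-distribʳ-* 10 10 j)))
                           (pow-outgrows 169 31 N j (≤-trans J≤j (m≤m*n j 31)))

ProductBelow33/32From : ℕ → NatSet → NatSet → Set
ProductBelow33/32From X A B = ∀ x → X ≤ x → 32 * (count A x * count B x) ≤ 33 * x

product-below-swap : ∀ {X A B} → ProductBelow33/32From X A B → ProductBelow33/32From X B A
product-below-swap {A = A} {B} upper x X≤x =
  subst (λ t → 32 * t ≤ 33 * x) (*-comm (count A x) (count B x)) (upper x X≤x)

limsup⇒product-below-33/32 : ∀ {A B} → LimsupProductBelow A B → ∃[ X ] ProductBelow33/32From X A B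
limsup⇒product-below-33/32 {A} {B} (p , r , 0<r , p/r<1+C₀ , X , below) = X , λ x X≤x →
  ≤-33/32-scaled {p} {r} {count A x * count B x} {x} 0<r (1+C₀<33/32 {p} {r} p/r<1+C₀) (below x X≤x)

module Growth (A B : NatSet) (n₀ X : ℕ) (cover : SumsCoverFrom n₀ A B)
              (upper : ProductBelow33/32From X A B) where

  T : ℕ
  T = suc (X + 50 * n₀)

  X≤ : ∀ {y} → T ≤ y → X ≤ y
  X≤ T≤y = ≤-trans (m≤n⇒m≤1+n (m≤m+n X (50 * n₀))) T≤y

  50n₀≤ : ∀ {y} → T ≤ y → 50 * n₀ ≤ y
  50n₀≤ T≤y = ≤-trans (m≤n⇒m≤1+n (m≤n+m (50 * n₀) X)) T≤y

  slow-dichotomy : ∀ {y} → T ≤ y → Slow A y ⊎ Slow B y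
  slow-dichotomy {y} T≤y with 10 * count A (2 * y) ≤? 13 * count A y
                            | 10 * count B (2 * y) ≤? 13 * count B y
  ... | yes slowA | _         = inj₁ slowA
  ... | no _      | yes slowB = inj₂ slowB
  ... | no fastA  | no fastB  =
    ⊥-elim (both-fast-impossible {n₀} {y} {a} {b} {D} {v} 40n₀≤y split (count-product-lower cover y)
                                 (not-slow⇒gap {a} fastA′) (not-slow⇒gap {b} fastB′) upper′)
    where
    y≤2y = m≤m+n y (y + 0)
    a = count A y
    b = count B y
    D = count (above y A) (2 * y)
    v = count (above y B) (2 * y)
    a+D≡ : a + D ≡ count A (2 * y)
    a+D≡ = count-above A y≤2y
    b+v≡ : b + v ≡ count B (2 * y)
    b+v≡ = count-above B y≤2y
    40n₀≤y : 40 * n₀ ≤ y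
    40n₀≤y = ≤-trans (*-monoˡ-≤ n₀ (m≤m+n 40 10)) (50n₀≤ T≤y)
    fastA′ : 10 * (a + D) ≰ 13 * a
    fastA′ rewrite a+D≡ = fastA
    fastB′ : 10 * (b + v) ≰ 13 * b
    fastB′ rewrite b+v≡ = fastB
    split : suc (2 * y) ≤ n₀ + (a * (b + v) + D * b)
    split rewrite b+v≡ = count-split-lower cover ≤-refl
    upper′ : 32 * ((a + D) * (b + v)) ≤ 33 * (2 * y)
    upper′ rewrite a+D≡ | b+v≡ = upper (2 * y) (X≤ (≤-trans T≤y y≤2y))

  no-slow-switch : ∀ {y} → T ≤ y → 20 ≤ count A (suc y) → Slow A y → ¬ Slow B (suc y)
  no-slow-switch {y} T≤y 20≤a slowA slowB =
    slow-switch-impossible {n₀} {y} {count A (suc y)} {count B (suc y)}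
                           {count A (2 * suc y)} {count B (2 * suc y)}
                           9n₀≤y (count-product-lower cover (2 * suc y)) a₂≤ slowB (upper (suc y) (X≤ (m≤n⇒m≤1+n T≤y)))
    where
    open ≤-Reasoning
    9n₀≤y : 9 * n₀ ≤ y
    9n₀≤y = ≤-trans (*-monoˡ-≤ n₀ (m≤m+n 9 41)) (50n₀≤ T≤y)
    a₂≤ : 10 * count A (2 * suc y) ≤ 14 * count A (suc y)
    a₂≤ = begin
      10 * count A (2 * suc y)                 ≡⟨ cong (λ t → 10 * count A t) (*-suc 2 y) ⟩
      10 * count A (2 + 2 * y)                 ≤⟨ *-monoʳ-≤ 10 (count-+-≤ A 2 (2 * y)) ⟩
      10 * (count A (2 * y) + 2)               ≡⟨ *-distribˡ-+ 10 (count A (2 * y)) 2 ⟩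
      10 * count A (2 * y) + 20                ≤⟨ +-monoˡ-≤ 20 slowA ⟩
      13 * count A y + 20                      ≤⟨ +-mono-≤ (*-monoʳ-≤ 13 (count-mono A (n≤1+n y))) 20≤a ⟩
      13 * count A (suc y) + count A (suc y)   ≡⟨ +-comm (13 * count A (suc y)) (count A (suc y)) ⟩
      14 * count A (suc y)                     ∎

  count-stalls : ∀ {w} → T ≤ w → count A w < 20 → count A (suc w) ≡ count A w
  count-stalls {w} T≤w a<20 with A (suc w) in A[w+1]
  ... | false = +-identityʳ (count A w)
  ... | true  = ⊥-elim (small-count-step-impossible (50n₀≤ T≤w) (≤-pred a<20) (count-product-lower cover w)
                                                    (count-mono B (n≤1+n w)) upper′)
    where
    upper′ : 32 * (suc (count A w) * count B (suc w)) ≤ 33 * suc w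
    upper′ = subst (λ t → 32 * (t * count B (suc w)) ≤ 33 * suc w) (count-suc-true A A[w+1])
                   (upper (suc w) (X≤ (m≤n⇒m≤1+n T≤w)))

  count-constant : ∀ {w x} → T ≤ w → count A w < 20 → w ≤′ x → count A x ≡ count A w
  count-constant T≤w a<20 ≤′-refl = refl
  count-constant T≤w a<20 (≤′-step w≤′x) =
    trans (count-stalls (≤-trans T≤w (≤′⇒≤ w≤′x)) (subst (_< 20) (sym a[x]≡a[w]) a<20)) a[x]≡a[w]
    where a[x]≡a[w] = count-constant T≤w a<20 w≤′x

  slow-step : ∀ {y} → T ≤ y → Slow A y → Slow A (suc y)
  slow-step {y} T≤y slowA with 20 ≤? count A (suc y)
  ... | yes 20≤a = [ id , ⊥-elim ∘ no-slow-switch T≤y 20≤a slowA ]′ (slow-dichotomy (m≤n⇒m≤1+n T≤y))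
  ... | no  a≱20 rewrite count-constant (m≤n⇒m≤1+n T≤y) (≰⇒> a≱20) (≤⇒≤′ (m≤m+n (suc y) (suc y + 0))) =
    *-monoˡ-≤ (count A (suc y)) (m≤m+n 10 3)

  slow-forever : Slow A T → ∀ y → T ≤ y → Slow A y
  slow-forever slowT _ = slow-from ∘ ≤⇒≤′
    where
    slow-from : ∀ {y} → T ≤′ y → Slow A y
    slow-from ≤′-refl          = slowT
    slow-from (≤′-step T≤′y) = slow-step (≤′⇒≤ T≤′y) (slow-from T≤′y)

  slow⇒square-growth : (∀ y → T ≤ y → Slow A y) → ∀ M → Eventually (λ x → M * x ≤ count B x * count B x)
  slow⇒square-growth =
    slow-doubling⇒square-growth {f = count A} {n₀ = n₀} (count-mono B) (count-product-lower cover) 2n₀≤T z<s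
    where
    2n₀≤T : 2 * n₀ ≤ T
    2n₀≤T = ≤-trans (*-monoˡ-≤ n₀ (m≤m+n 2 48)) (50n₀≤ ≤-refl)

module _ (A B : NatSet) (n₀ X : ℕ) (cover : SumsCoverFrom n₀ A B)
         (upper : ProductBelow33/32From X A B) where

  private
    module AB = Growth A B n₀ X cover upper
    module BA = Growth B A n₀ X (sums-cover-swap cover) (product-below-swap upper)

    square-widen : ∀ {M x m n} → m ≤ n → M * x ≤ m * m → M * x ≤ n * n
    square-widen m≤n Mx≤m² = ≤-trans Mx≤m² (*-mono-≤ m≤n m≤n)

  max-square-grows : ∀ M → Eventually (λ x → M * x ≤ (count A x ⊔ count B x) * (count A x ⊔ count B x))
  max-square-grows M with AB.slow-dichotomy {AB.T} ≤-refl
  ... | inj₁ slowA = eventually-mono (λ x → square-widen {M} {x} (m≤n⊔m (count A x) (count B x)))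
                                     (AB.slow⇒square-growth (AB.slow-forever slowA) M)
  ... | inj₂ slowB = eventually-mono (λ x → square-widen {M} {x} (m≤m⊔n (count A x) (count B x)))
                                     (BA.slow⇒square-growth (BA.slow-forever slowB) M)

corollary2 : (A B : NatSet) → AdditiveComplements A B → LimsupProductBelow A B →
    MaxOverSqrtTendsToInfinity A B
corollary2 A B (n₀ , cover) limsup =
  let X , upper = limsup⇒product-below-33/32 limsup in max-square-grows A B n₀ X cover upper
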